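{- Let $q$ be a prime power, $m,n$ positive integers, and $\alpha\in\mathbb{F}_{q^{mn}}$ with $\mathbb{F}_{q^{mn}}=\mathbb{F}_q(\alpha)$. Let $N(\alpha,m,n;q)$ be the number of ordered $\mathbb{F}_q$-bases of $\mathbb{F}_{q^{mn}}$ of the form $(v_1,\dots,v_m,\alpha v_1,\dots,\alpha v_m,\dots,\alpha^{n-1}v_1,\dots,\alpha^{n-1}v_m)$ with $v_1,\dots,v_m\in\mathbb{F}_{q^{mn}}$. Then $$\frac{(q-2)q^{mn}+1}{q-1}\,q^{mn(m-1)}\le N(\alpha,m,n;q)\le\prod_{i=0}^{m-1}(q^{mn}-q^i).$$ -}

module Defs where

open import Level using (Level; _⊔_)
open import Algebra.Bundles using (CommutativeRing)
open import Data.Nat as ℕ using (ℕ; zero; suc)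
open import Data.Fin using (Fin; zero; suc; toℕ; remQuot)
open import Data.Product using (Σ; ∃; ∃-syntax; _×_; _,_; proj₁; proj₂)
open import Relation.Nullary using (¬_)
open import Relation.Binary.PropositionalEquality using (_≡_)

∏ℕ : (m : ℕ) → (ℕ → ℕ) → ℕ
∏ℕ zero    f = 1
∏ℕ (suc m) f = ∏ℕ m f ℕ.* f m

module _ {c ℓ : Level} (R : CommutativeRing c ℓ) where
  open CommutativeRing R hiding (zero)

  IsField : Set (c ⊔ ℓ)
  IsField = (¬ (0# ≈ 1#)) × (∀ x → ¬ (x ≈ 0#) → ∃[ y ] (x * y ≈ 1#))

  HasSize : ℕ → Set (c ⊔ ℓ)
  HasSize N = Σ (Fin N → Carrier) λ e →
    (∀ i j → e i ≈ e j → i ≡ j) × (∀ x → ∃[ i ] (e i ≈ x))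

  record IsSubfield {p : Level} (S : Carrier → Set p) : Set (c ⊔ ℓ ⊔ p) where
    field
      resp  : ∀ {x y} → x ≈ y → S x → S y
      has0  : S 0#
      has1  : S 1#
      clos+ : ∀ {x y} → S x → S y → S (x + y)
      clos- : ∀ {x} → S x → S (- x)
      clos* : ∀ {x y} → S x → S y → S (x * y)
      closInv : ∀ {x y} → S x → x * y ≈ 1# → S y

  Image : ∀ {k} → (Fin k → Carrier) → Carrier → Set ℓ
  Image ι x = ∃[ a ] (ι a ≈ x)

  pow : Carrier → ℕ → Carrier
  pow x zero    = 1#
  pow x (suc k) = pow x k * x

  Σᶠ : (d : ℕ) → (Fin d → Carrier) → Carrier
  Σᶠ zero    f = 0#
  Σᶠ (suc d) f = f zero + Σᶠ d (λ i → f (suc i))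

  -- Linear algebra over the subfield  F = image of ι : Fin q → Carrier
  module OverSubfield {q : ℕ} (ι : Fin q → Carrier) where

    lincomb : {d : ℕ} → (Fin d → Fin q) → (Fin d → Carrier) → Carrier
    lincomb {d} cf w = Σᶠ d (λ i → ι (cf i) * w i)

    LinIndep : {d : ℕ} → (Fin d → Carrier) → Set ℓ
    LinIndep {d} w = ∀ (cf : Fin d → Fin q) → lincomb cf w ≈ 0# → ∀ i → ι (cf i) ≈ 0#

    Spans : {d : ℕ} → (Fin d → Carrier) → Set (c ⊔ ℓ)
    Spans {d} w = ∀ x → ∃[ cf ] (lincomb cf w ≈ x)

    IsBasis : {d : ℕ} → (Fin d → Carrier) → Set (c ⊔ ℓ)
    IsBasis w = LinIndep w × Spans w

    -- K = F(α): the only subfield containing F and α is everything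
    Generates : Carrier → Set (c ⊔ Level.suc ℓ)
    Generates α = ∀ (S : Carrier → Set ℓ) → IsSubfield S → (∀ a → S (ι a)) → S α → ∀ x → S x

    -- the family (v_1..v_m, α v_1..α v_m, …, α^{n-1} v_1..α^{n-1} v_m);
    -- index combine i j (= i*m + j) holds α^i v_j
    family : (m n : ℕ) → Carrier → (Fin m → Carrier) → Fin (n ℕ.* m) → Carrier
    family m n α v x = pow α (toℕ (proj₁ (remQuot {n} m x))) * v (proj₂ (remQuot {n} m x))

    GoodTuple : (m n : ℕ) → Carrier → (Fin m → Carrier) → Set (c ⊔ ℓ)
    GoodTuple m n α v = IsBasis (family m n α v)

    -- N is the number of tuples v ∈ K^m for which the family is an ordered F-basis:
    -- an enumeration Fin N → K^m, injective and with image exactly the good tuples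
    -- (tuples compared pointwise up to ≈)
    IsCountOfBases : (m n : ℕ) → Carrier → ℕ → Set (c ⊔ ℓ)
    IsCountOfBases m n α N = Σ (Fin N → (Fin m → Carrier)) λ f →
        (∀ k → GoodTuple m n α (f k))
      × (∀ k k' → (∀ j → f k j ≈ f k' j) → k ≡ k')
      × (∀ v → GoodTuple m n α v → ∃[ k ] (∀ j → f k j ≈ v j))

module Submission where

-- A good tuple v is itself F-independent (a relation among the
-- v_j is one among the α^0 v_j), and an independent k-tuple extends to an
-- independent (k+1)-tuple in at most Q - q^k ways; so N ≤ ∏_{i<m} (Q - q^i).
--
-- A matrix P ∈ F^{n×m} acts on v by the form Σ_j c_j v_j with
-- c_j = Σ_i P_ij α^i; v is bad when some nonzero P kills it.  Since
-- 1, α, …, α^(n-1) are independent, a nonzero P has some c_j ≠ 0, so it kills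
-- at most Q^(m-1) tuples; a bad tuple is killed by the q-1 nonzero multiples
-- of P.  Double counting gives bad·(q-1) ≤ (Q-1)·Q^(m-1), and every other
-- tuple is good, because nm independent vectors span K.

open import Level using (Level)
open import Defs
open import Algebra.Bundles using (CommutativeMonoid; Semiring; CommutativeRing)
open import Data.Nat as ℕ using (ℕ; zero; suc; _∸_; z≤n; s≤s)
import Data.Nat.Properties as ℕₚ
open import Data.Nat.Solver using (module +-*-Solver)
open import Data.Bool using (if_then_else_)
open import Data.Fin using (Fin; zero; suc; toℕ; inject₁; fromℕ; _↑ˡ_; _↑ʳ_; punchIn; punchOut; combine; remQuot; finToFun; funToFin)
open import Data.Fin.Properties
  using (suc-injective; nonZeroIndex; toℕ-inject₁; toℕ-fromℕ; punchIn-punchOut; punchOut-injective; finToFun-funToFin;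
         funToFin-finToFin; remQuot-combine; combine-remQuot; pigeonhole; injective⇒≤; any?; all?)
  renaming (_≟_ to _≟F_)
open import Data.Fin.Relation.Unary.Top using (view; ‵fromℕ; ‵inject₁)
open import Data.Vec.Functional using (Vector; _∷_)
open import Data.Product using (∃-syntax; _×_; _,_; proj₁; proj₂)
open import Data.Unit using (tt)
open import Function using (_∘_)
open import Relation.Nullary using (¬_; Dec; yes; no; does; contradiction)
open import Relation.Nullary.Decidable using (¬?; _×-dec_; _→-dec_; map′)
open import Relation.Unary using (Pred; Decidable)
open import Relation.Binary.PropositionalEquality as ≡ using (_≡_; _≢_)

module SumDecomposition {a ℓ} (M : CommutativeMonoid a ℓ) where
  open CommutativeMonoid M
  open import Algebra.Properties.CommutativeMonoid.Sum M using (sum; sum-syntax)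

  sum-↑ : ∀ k l (f : Vector Carrier (k ℕ.+ l)) →
          sum f ≈ sum (λ i → f (i ↑ˡ l)) ∙ sum (λ j → f (k ↑ʳ j))
  sum-↑ zero    l f = sym (identityˡ _)
  sum-↑ (suc k) l f = trans (∙-congˡ (sum-↑ k l (f ∘ suc))) (sym (assoc _ _ _))

  sum-combine : ∀ k l (f : Vector Carrier (k ℕ.* l)) →
                sum f ≈ ∑[ i < k ] ∑[ j < l ] f (combine i j)
  sum-combine zero    l f = refl
  sum-combine (suc k) l f =
    trans (sum-↑ l (k ℕ.* l) f) (∙-congˡ (sum-combine k l (λ x → f (l ↑ʳ x))))

-- Counting the elements of Fin k satisfying a decidable predicate, as a sum
-- of indicators; this makes double counting a mere exchange of sums.
module Counting where
  open import Algebra.Properties.Semiring.Sum ℕₚ.+-*-semiring public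
    using (sum; sum-syntax; sum-cong-≗; sum-remove; ∑-comm; *-distribʳ-sum; ∑-distrib-+)
  open SumDecomposition (Semiring.+-commutativeMonoid ℕₚ.+-*-semiring) public

  private variable p r : Level

  𝟙 : {P : Set p} → Dec P → ℕ
  𝟙 P? = if does P? then 1 else 0

  count : (k : ℕ) {P : Pred (Fin k) p} → Decidable P → ℕ
  count k P? = ∑[ i < k ] 𝟙 (P? i)

  sum-mono-≤ : ∀ k {f g : Fin k → ℕ} → (∀ i → f i ℕ.≤ g i) → sum f ℕ.≤ sum g
  sum-mono-≤ zero    f≤g = z≤n
  sum-mono-≤ (suc k) f≤g = ℕₚ.+-mono-≤ (f≤g zero) (sum-mono-≤ k (f≤g ∘ suc))

  𝟙-yes : {P : Set p} (P? : Dec P) → P → 𝟙 P? ≡ 1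
  𝟙-yes (yes _) _  = ≡.refl
  𝟙-yes (no ¬P) pf = contradiction pf ¬P

  𝟙≤1 : {P : Set p} (P? : Dec P) → 𝟙 P? ℕ.≤ 1
  𝟙≤1 (yes _) = s≤s z≤n
  𝟙≤1 (no _)  = z≤n

  𝟙-mono : {P : Set p} {R : Set r} (P? : Dec P) (R? : Dec R) → (P → R) → 𝟙 P? ℕ.≤ 𝟙 R?
  𝟙-mono (yes pf) R? P⇒R = ℕₚ.≤-reflexive (≡.sym (𝟙-yes R? (P⇒R pf)))
  𝟙-mono (no _)   R? P⇒R = z≤n

  count-all : ∀ k → count k (λ (_ : Fin k) → yes tt) ≡ k
  count-all zero    = ≡.refl
  count-all (suc k) = ≡.cong suc (count-all k)

  count≤ : ∀ k {P : Pred (Fin k) p} (P? : Decidable P) → count k P? ℕ.≤ k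
  count≤ k P? = ℕₚ.≤-trans (sum-mono-≤ k (𝟙≤1 ∘ P?)) (ℕₚ.≤-reflexive (count-all k))

  count-mono : ∀ k {P : Pred (Fin k) p} {R : Pred (Fin k) r} (P? : Decidable P) (R? : Decidable R) →
               (∀ i → P i → R i) → count k P? ℕ.≤ count k R?
  count-mono k P? R? P⇒R = sum-mono-≤ k (λ i → 𝟙-mono (P? i) (R? i) (P⇒R i))

  𝟙-complement : {P : Set p} (P? : Dec P) → 𝟙 P? ℕ.+ 𝟙 (¬? P?) ≡ 1
  𝟙-complement (yes _) = ≡.refl
  𝟙-complement (no _)  = ≡.refl

  count-complement : ∀ k {P : Pred (Fin k) p} (P? : Decidable P) →
                     count k P? ℕ.+ count k (¬? ∘ P?) ≡ k
  count-complement k P? = begin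
    count k P? ℕ.+ count k (¬? ∘ P?)      ≡⟨ ∑-distrib-+ (𝟙 ∘ P?) (𝟙 ∘ ¬? ∘ P?) ⟨
    ∑[ i < k ] (𝟙 (P? i) ℕ.+ 𝟙 (¬? (P? i))) ≡⟨ sum-cong-≗ (𝟙-complement ∘ P?) ⟩
    count k (λ (_ : Fin k) → yes tt)      ≡⟨ count-all k ⟩
    k                                     ∎
    where open ≡.≡-Reasoning

  count-¬-≤ : ∀ k {c} {P : Pred (Fin k) p} (P? : Decidable P) →
              c ℕ.≤ count k P? → count k (¬? ∘ P?) ℕ.≤ k ∸ c
  count-¬-≤ k {c} P? c≤ = begin
    count k (¬? ∘ P?)                                ≡⟨ ℕₚ.m+n∸m≡n (count k P?) _ ⟨
    count k P? ℕ.+ count k (¬? ∘ P?) ∸ count k P?    ≡⟨ ≡.cong (_∸ count k P?) (count-complement k P?) ⟩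
    k ∸ count k P?                                   ≤⟨ ℕₚ.∸-monoʳ-≤ k c≤ ⟩
    k ∸ c                                            ∎
    where open ℕₚ.≤-Reasoning

  ≤-count-¬ : ∀ k {c} {P : Pred (Fin k) p} (P? : Decidable P) →
              count k P? ℕ.≤ c → k ∸ c ℕ.≤ count k (¬? ∘ P?)
  ≤-count-¬ k {c} P? ≤c = begin
    k ∸ c                                            ≤⟨ ℕₚ.∸-monoʳ-≤ k ≤c ⟩
    k ∸ count k P?                                   ≡⟨ ≡.cong (_∸ count k P?) (count-complement k P?) ⟨
    count k P? ℕ.+ count k (¬? ∘ P?) ∸ count k P?    ≡⟨ ℕₚ.m+n∸m≡n (count k P?) _ ⟩
    count k (¬? ∘ P?)                                ∎
    where open ℕₚ.≤-Reasoning

  count-≤-∸ : ∀ k {c} {P : Pred (Fin k) p} (P? : Decidable P) →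
              c ℕ.≤ count k (¬? ∘ P?) → count k P? ℕ.≤ k ∸ c
  count-≤-∸ k {c} P? c≤ = begin
    count k P?                                       ≡⟨ ℕₚ.m+n∸n≡m (count k P?) (count k (¬? ∘ P?)) ⟨
    count k P? ℕ.+ count k (¬? ∘ P?) ∸ count k (¬? ∘ P?) ≡⟨ ≡.cong (_∸ count k (¬? ∘ P?)) (count-complement k P?) ⟩
    k ∸ count k (¬? ∘ P?)                            ≤⟨ ℕₚ.∸-monoʳ-≤ k c≤ ⟩
    k ∸ c                                            ∎
    where open ℕₚ.≤-Reasoning

  count-punchIn : ∀ k {R : Pred (Fin (suc k)) r} (R? : Decidable R) (t : Fin (suc k)) → R t →
                  count (suc k) R? ≡ suc (count k (R? ∘ punchIn t))
  count-punchIn k R? t Rt = ≡.trans (sum-remove {i = t} (𝟙 ∘ R?)) (≡.cong (ℕ._+ count k (R? ∘ punchIn t)) (𝟙-yes (R? t) Rt))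

  -- Induction on a: the image t of zero is removed from Fin b by 'punchOut'.
  count-injection : ∀ a b {P : Pred (Fin a) p} {R : Pred (Fin b) r}
    (P? : Decidable P) (R? : Decidable R) (g : ∀ i → P i → Fin b) →
    (∀ i pf → R (g i pf)) → (∀ i i' pf pf' → g i pf ≡ g i' pf' → i ≡ i') →
    count a P? ℕ.≤ count b R?
  count-injection zero b P? R? g g-R g-inj = z≤n
  count-injection (suc a) b P? R? g g-R g-inj with P? zero
  ... | no ¬p₀ = count-injection a b (P? ∘ suc) R? (g ∘ suc) (g-R ∘ suc)
                   (λ i i' pf pf' eq → suc-injective (g-inj _ _ pf pf' eq))
  count-injection (suc a) zero    P? R? g g-R g-inj | yes p₀ with () ← g zero p₀
  count-injection (suc a) (suc b) {P} {R} P? R? g g-R g-inj | yes p₀ = begin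
    suc (count a (P? ∘ suc))                ≤⟨ s≤s (count-injection a b (P? ∘ suc) (R? ∘ punchIn t) g′ g′-R g′-inj) ⟩
    suc (count b (R? ∘ punchIn t))          ≡⟨ count-punchIn b R? t (g-R zero p₀) ⟨
    count (suc b) R?                        ∎
    where
    open ℕₚ.≤-Reasoning
    t = g zero p₀
    t≢ : ∀ i pf → t ≢ g (suc i) pf
    t≢ i pf eq = contradiction (g-inj _ _ p₀ pf eq) λ ()
    g′ : ∀ i → P (suc i) → Fin b
    g′ i pf = punchOut (t≢ i pf)
    g′-R : ∀ i pf → R (punchIn t (g′ i pf))
    g′-R i pf = ≡.subst R (≡.sym (punchIn-punchOut (t≢ i pf))) (g-R (suc i) pf)
    g′-inj : ∀ i i' pf pf' → g′ i pf ≡ g′ i' pf' → i ≡ i'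
    g′-inj i i' pf pf' eq = suc-injective (g-inj _ _ pf pf' (punchOut-injective (t≢ i pf) (t≢ i' pf') eq))

  count-none : ∀ k {P : Pred (Fin k) p} (P? : Decidable P) → (∀ i → ¬ P i) → count k P? ≡ 0
  count-none zero    P? none = ≡.refl
  count-none (suc k) P? none with P? zero
  ... | yes p₀ = contradiction p₀ (none zero)
  ... | no _   = count-none k (P? ∘ suc) (none ∘ suc)

  𝟙*-≤ : ∀ {c n} {P : Set p} (P? : Dec P) → (P → c ℕ.≤ n) → 𝟙 P? ℕ.* c ℕ.≤ n
  𝟙*-≤ {c = c} (yes pf) c≤n = ℕₚ.≤-trans (ℕₚ.≤-reflexive (ℕₚ.*-identityˡ c)) (c≤n pf)
  𝟙*-≤     (no _)   c≤n = z≤n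

  ≤-𝟙* : ∀ {c n} {P : Set p} (P? : Dec P) → (P → n ℕ.≤ c) → (¬ P → n ≡ 0) → n ℕ.≤ 𝟙 P? ℕ.* c
  ≤-𝟙* {c = c} (yes pf)  n≤c n≡0 = ℕₚ.≤-trans (n≤c pf) (ℕₚ.≤-reflexive (≡.sym (ℕₚ.*-identityˡ c)))
  ≤-𝟙*     (no ¬pf)  n≤c n≡0 = ℕₚ.≤-reflexive (n≡0 ¬pf)

  count-pairs : ∀ a b {P : Pred (Fin (a ℕ.* b)) p} {A : Pred (Fin b) r}
    (P? : Decidable P) (A? : Decidable A) c →
    (∀ x t → P (combine x t) → A t) → (∀ t → A t → count a (λ x → P? (combine x t)) ℕ.≤ c) →
    count (a ℕ.* b) P? ℕ.≤ count b A? ℕ.* c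
  count-pairs a b P? A? c P⇒A fibre≤ = begin
    count (a ℕ.* b) P?                              ≡⟨ sum-combine a b (λ i → 𝟙 (P? i)) ⟩
    ∑[ x < a ] ∑[ t < b ] 𝟙 (P? (combine x t))      ≡⟨ ∑-comm {a} {b} (λ x t → 𝟙 (P? (combine x t))) ⟩
    ∑[ t < b ] count a (λ x → P? (combine x t))     ≤⟨ sum-mono-≤ b (λ t → ≤-𝟙* (A? t) (fibre≤ t)
                                                         (λ ¬A → count-none a (λ x → P? (combine x t)) (λ x pf → ¬A (P⇒A x t pf)))) ⟩
    ∑[ t < b ] (𝟙 (A? t) ℕ.* c)                     ≡⟨ *-distribʳ-sum c (λ t → 𝟙 (A? t)) ⟨
    count b A? ℕ.* c                                ∎
    where open ℕₚ.≤-Reasoning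

  double-counting : ∀ a b {R : Fin a → Fin b → Set p} {A : Pred (Fin a) r} {B : Pred (Fin b) r}
    (R? : ∀ i j → Dec (R i j)) (A? : Decidable A) (B? : Decidable B) cA cB →
    (∀ i → A i → cA ℕ.≤ count b (R? i)) → (∀ j → B j → count a (λ i → R? i j) ℕ.≤ cB) →
    (∀ i j → R i j → B j) → count a A? ℕ.* cA ℕ.≤ count b B? ℕ.* cB
  double-counting a b R? A? B? cA cB rows≥ columns≤ R⇒B = begin
    count a A? ℕ.* cA                        ≡⟨ *-distribʳ-sum cA (λ i → 𝟙 (A? i)) ⟩
    ∑[ i < a ] (𝟙 (A? i) ℕ.* cA)             ≤⟨ sum-mono-≤ a (λ i → 𝟙*-≤ (A? i) (rows≥ i)) ⟩
    ∑[ i < a ] count b (R? i)                ≡⟨ ∑-comm {a} {b} (λ i j → 𝟙 (R? i j)) ⟩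
    ∑[ j < b ] count a (λ i → R? i j)        ≤⟨ sum-mono-≤ b (λ j → ≤-𝟙* (B? j) (columns≤ j)
                                                  (λ ¬B → count-none a (λ i → R? i j) (λ i r → ¬B (R⇒B i j r)))) ⟩
    ∑[ j < b ] (𝟙 (B? j) ℕ.* cB)             ≡⟨ *-distribʳ-sum cB (λ j → 𝟙 (B? j)) ⟨
    count b B? ℕ.* cB                        ∎
    where open ℕₚ.≤-Reasoning

lower-bound-arithmetic : ∀ q Q X good bad N → 2 ℕ.≤ q → 1 ℕ.≤ Q →
  bad ℕ.* (q ∸ 1) ℕ.≤ (Q ∸ 1) ℕ.* X → bad ℕ.+ good ≡ Q ℕ.* X → good ℕ.≤ N →
  ((q ∸ 2) ℕ.* Q ℕ.+ 1) ℕ.* X ℕ.≤ (q ∸ 1) ℕ.* N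
lower-bound-arithmetic (suc (suc r)) (suc Q′) X good bad N (s≤s (s≤s z≤n)) (s≤s z≤n) bad≤ total good≤ =
  ℕₚ.≤-trans (ℕₚ.+-cancelʳ-≤ (Q′ ℕ.* X) _ _ chain) (ℕₚ.*-monoʳ-≤ (suc r) good≤)
  where
  open ℕₚ.≤-Reasoning
  open +-*-Solver
  identity : (r ℕ.* suc Q′ ℕ.+ 1) ℕ.* X ℕ.+ Q′ ℕ.* X ≡ suc r ℕ.* (suc Q′ ℕ.* X)
  identity = solve 3 (λ r Q′ X → (r :* (con 1 :+ Q′) :+ con 1) :* X :+ Q′ :* X
                                 := (con 1 :+ r) :* ((con 1 :+ Q′) :* X)) ≡.refl r Q′ X
  chain : (r ℕ.* suc Q′ ℕ.+ 1) ℕ.* X ℕ.+ Q′ ℕ.* X ℕ.≤ suc r ℕ.* good ℕ.+ Q′ ℕ.* X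
  chain = begin
    (r ℕ.* suc Q′ ℕ.+ 1) ℕ.* X ℕ.+ Q′ ℕ.* X  ≡⟨ identity ⟩
    suc r ℕ.* (suc Q′ ℕ.* X)                ≡⟨ ≡.cong (suc r ℕ.*_) total ⟨
    suc r ℕ.* (bad ℕ.+ good)                ≡⟨ ℕₚ.*-distribˡ-+ (suc r) bad good ⟩
    suc r ℕ.* bad ℕ.+ suc r ℕ.* good        ≡⟨ ℕₚ.+-comm (suc r ℕ.* bad) _ ⟩
    suc r ℕ.* good ℕ.+ suc r ℕ.* bad        ≤⟨ ℕₚ.+-monoʳ-≤ (suc r ℕ.* good) (ℕₚ.≤-trans (ℕₚ.≤-reflexive (ℕₚ.*-comm (suc r) bad)) bad≤) ⟩
    suc r ℕ.* good ℕ.+ Q′ ℕ.* X             ∎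

funToFin-cong : ∀ {k m} {f g : Fin k → Fin m} → (∀ i → f i ≡ g i) → funToFin f ≡ funToFin g
funToFin-cong {zero}  f≗g = ≡.refl
funToFin-cong {suc k} f≗g = ≡.cong₂ combine (f≗g zero) (funToFin-cong (f≗g ∘ suc))

finToFun-injective : ∀ {k m} (a b : Fin (m ℕ.^ k)) → (∀ i → finToFun {m} {k} a i ≡ finToFun {m} {k} b i) → a ≡ b
finToFun-injective {k} {m} a b a≗b = begin
  a                              ≡⟨ funToFin-finToFin {k} {m} a ⟨
  funToFin (finToFun {m} {k} a)  ≡⟨ funToFin-cong a≗b ⟩
  funToFin (finToFun {m} {k} b)  ≡⟨ funToFin-finToFin {k} {m} b ⟩
  b                              ∎
  where open ≡.≡-Reasoning

module _ {c ℓ : Level} (K : CommutativeRing c ℓ) where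
  open CommutativeRing K hiding (zero)
  open import Algebra.Properties.Ring ring using (-1*x≈-x; -‿distribˡ-*; +-inverseʳ-unique; x∙y⁻¹≈ε⇒x≈y)
  open import Algebra.Properties.Semiring.Sum semiring
    using (sum; sum-syntax; sum-cong-≋; sum-replicate-zero; sum-init-last; sum-remove; ∑-distrib-+; ∑-comm; *-distribˡ-sum; *-distribʳ-sum)
  open SumDecomposition +-commutativeMonoid using (sum-combine)
  open import Relation.Binary.Reasoning.Setoid setoid

  Σᶠ≡sum : ∀ d (f : Fin d → Carrier) → Σᶠ K d f ≡ sum f
  Σᶠ≡sum zero    f = ≡.refl
  Σᶠ≡sum (suc d) f = ≡.cong (f zero +_) (Σᶠ≡sum d (f ∘ suc))

  sum-zero : ∀ {d} {f : Fin d → Carrier} → (∀ i → f i ≈ 0#) → sum f ≈ 0#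
  sum-zero {d} f≈0 = trans (sum-cong-≋ f≈0) (sum-replicate-zero d)

  -‿sum : ∀ {d} (f : Fin d → Carrier) → - sum f ≈ ∑[ i < d ] (- f i)
  -‿sum f = begin
    - sum f              ≈⟨ -1*x≈-x (sum f) ⟨
    - 1# * sum f         ≈⟨ *-distribˡ-sum (- 1#) f ⟩
    sum (λ i → - 1# * f i) ≈⟨ sum-cong-≋ (λ i → -1*x≈-x (f i)) ⟩
    sum (λ i → - f i)    ∎

  pow-+ : ∀ x a b → pow K x (a ℕ.+ b) ≈ pow K x a * pow K x b
  pow-+ x a zero    = trans (reflexive (≡.cong (pow K x) (ℕₚ.+-identityʳ a))) (sym (*-identityʳ _))
  pow-+ x a (suc b) = trans (reflexive (≡.cong (pow K x) (ℕₚ.+-suc a b)))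
                            (trans (*-cong (pow-+ x a b) refl) (*-assoc _ _ _))

  module _ (isField : IsField K) where

    0≉1 : ¬ (0# ≈ 1#)
    0≉1 = proj₁ isField

    inverse : ∀ x → ¬ (x ≈ 0#) → ∃[ y ] (x * y ≈ 1#)
    inverse = proj₂ isField

    *-cancelˡ : ∀ {x y z} → ¬ (x ≈ 0#) → x * y ≈ x * z → y ≈ z
    *-cancelˡ {x} {y} {z} x≉0 xy≈xz = begin
      y               ≈⟨ *-identityˡ y ⟨
      1# * y          ≈⟨ *-cong x⁻¹x≈1 refl ⟨
      (x⁻¹ * x) * y   ≈⟨ *-assoc _ _ _ ⟩
      x⁻¹ * (x * y)   ≈⟨ *-cong refl xy≈xz ⟩
      x⁻¹ * (x * z)   ≈⟨ *-assoc _ _ _ ⟨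
      (x⁻¹ * x) * z   ≈⟨ *-cong x⁻¹x≈1 refl ⟩
      1# * z          ≈⟨ *-identityˡ z ⟩
      z               ∎
      where
      x⁻¹ = proj₁ (inverse x x≉0)
      x⁻¹x≈1 : x⁻¹ * x ≈ 1#
      x⁻¹x≈1 = trans (*-comm _ _) (proj₂ (inverse x x≉0))

    *-nonzero : ∀ {x y} → ¬ (x ≈ 0#) → ¬ (y ≈ 0#) → ¬ (x * y ≈ 0#)
    *-nonzero {x} x≉0 y≉0 xy≈0 = y≉0 (*-cancelˡ x≉0 (trans xy≈0 (sym (zeroʳ x))))

    pow-nonzero : ∀ {x} → ¬ (x ≈ 0#) → ∀ k → ¬ (pow K x k ≈ 0#)
    pow-nonzero x≉0 zero    1≈0 = 0≉1 (sym 1≈0)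
    pow-nonzero x≉0 (suc k) = *-nonzero (pow-nonzero x≉0 k) x≉0

    coordinate-determined : ∀ {k} (c v v′ : Fin (suc k) → Carrier) j₀ → ¬ (c j₀ ≈ 0#) →
      ∑[ j < suc k ] (c j * v j) ≈ 0# → ∑[ j < suc k ] (c j * v′ j) ≈ 0# →
      (∀ j → v (punchIn j₀ j) ≈ v′ (punchIn j₀ j)) → v j₀ ≈ v′ j₀
    coordinate-determined {k} c v v′ j₀ c≉0 v-solves v′-solves agree = *-cancelˡ c≉0 (begin
      c j₀ * v j₀     ≈⟨ +-inverseʳ-unique (rest v) _ (isolate v v-solves) ⟩
      - rest v        ≈⟨ -‿cong (sum-cong-≋ (λ j → *-cong refl (agree j))) ⟩
      - rest v′       ≈⟨ +-inverseʳ-unique (rest v′) _ (isolate v′ v′-solves) ⟨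
      c j₀ * v′ j₀    ∎)
      where
      rest : (Fin (suc k) → Carrier) → Carrier
      rest u = ∑[ j < k ] (c (punchIn j₀ j) * u (punchIn j₀ j))
      isolate : ∀ u → ∑[ j < suc k ] (c j * u j) ≈ 0# → rest u + c j₀ * u j₀ ≈ 0#
      isolate u solves = trans (+-comm _ _) (trans (sym (sum-remove {i = j₀} (λ j → c j * u j))) solves)

    module Finite {Q : ℕ} (size : HasSize K Q) where

      element : Fin Q → Carrier
      element = proj₁ size

      element-injective : ∀ i j → element i ≈ element j → i ≡ j
      element-injective = proj₁ (proj₂ size)

      index : Carrier → Fin Q
      index x = proj₁ (proj₂ (proj₂ size) x)

      element-index : ∀ x → element (index x) ≈ x
      element-index x = proj₂ (proj₂ (proj₂ size) x)

      index-cong : ∀ {x y} → x ≈ y → index x ≡ index y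
      index-cong {x} {y} x≈y =
        element-injective _ _ (trans (element-index x) (trans x≈y (sym (element-index y))))

      index-injective : ∀ {x y} → index x ≡ index y → x ≈ y
      index-injective {x} {y} eq =
        trans (sym (element-index x)) (trans (reflexive (≡.cong element eq)) (element-index y))

      infix 4 _≈?_
      _≈?_ : ∀ x y → Dec (x ≈ y)
      x ≈? y = map′ index-injective index-cong (index x ≟F index y)

      tuple : ∀ {k} → Fin (Q ℕ.^ k) → Fin k → Carrier
      tuple {k} a j = element (finToFun {Q} {k} a j)

      tuple-injective : ∀ {k} (a b : Fin (Q ℕ.^ k)) → (∀ j → tuple {k} a j ≈ tuple {k} b j) → a ≡ b
      tuple-injective {k} a b a≈b = finToFun-injective {k} {Q} a b (λ j → element-injective _ _ (a≈b j))

      tupleIndex : ∀ {k} → (Fin k → Carrier) → Fin (Q ℕ.^ k)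
      tupleIndex v = funToFin (index ∘ v)

      tuple-tupleIndex : ∀ {k} (v : Fin k → Carrier) j → tuple {k} (tupleIndex v) j ≈ v j
      tuple-tupleIndex v j =
        trans (reflexive (≡.cong element (finToFun-funToFin (index ∘ v) j))) (element-index (v j))

      tuple-combine : ∀ {k} x (t : Fin (Q ℕ.^ k)) j →
                      tuple {suc k} (combine x t) j ≈ (element x ∷ tuple {k} t) j
      tuple-combine {k} x t zero =
        reflexive (≡.cong (element ∘ proj₁) (remQuot-combine {Q} {Q ℕ.^ k} x t))
      tuple-combine {k} x t (suc j) =
        reflexive (≡.cong (λ qr → tuple {k} (proj₂ qr) j) (remQuot-combine {Q} {Q ℕ.^ k} x t))

      -- In a finite field the inverse of x is a power of x: two of the Q+1
      -- powers x^0 … x^Q coincide, x^i ≈ x^(i+s+1), and cancelling gives x^s·x ≈ 1.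
      inverse-is-power : ∀ {x y} → x * y ≈ 1# → ∃[ s ] (pow K x s ≈ y)
      inverse-is-power {x} {y} xy≈1 with pigeonhole (ℕₚ.n<1+n Q) (λ k → index (pow K x (toℕ k)))
      ... | i , j , i<j , same = s , (begin
        pow K x s              ≈⟨ *-identityʳ _ ⟨
        pow K x s * 1#         ≈⟨ *-cong refl xy≈1 ⟨
        pow K x s * (x * y)    ≈⟨ *-assoc _ _ _ ⟨
        (pow K x s * x) * y    ≈⟨ *-cong xˢ⁺¹≈1 refl ⟩
        1# * y                 ≈⟨ *-identityˡ y ⟩
        y                      ∎)
        where
        x≉0 : ¬ (x ≈ 0#)
        x≉0 x≈0 = 0≉1 (trans (sym (zeroˡ y)) (trans (*-cong (sym x≈0) refl) xy≈1))
        s = toℕ j ∸ suc (toℕ i)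
        j≡i+s+1 : toℕ i ℕ.+ suc s ≡ toℕ j
        j≡i+s+1 = ≡.trans (ℕₚ.+-suc (toℕ i) s) (ℕₚ.m+[n∸m]≡n i<j)
        xˢ⁺¹≈1 : pow K x s * x ≈ 1#
        xˢ⁺¹≈1 = *-cancelˡ (pow-nonzero x≉0 (toℕ i)) (begin
          pow K x (toℕ i) * pow K x (suc s)   ≈⟨ pow-+ x (toℕ i) (suc s) ⟨
          pow K x (toℕ i ℕ.+ suc s)           ≡⟨ ≡.cong (pow K x) j≡i+s+1 ⟩
          pow K x (toℕ j)                     ≈⟨ index-injective same ⟨
          pow K x (toℕ i)                     ≈⟨ *-identityʳ _ ⟨
          pow K x (toℕ i) * 1#                ∎)

    module _ {q : ℕ} (ι : Fin q → Carrier) (ι-injective : ∀ a b → ι a ≈ ι b → a ≡ b)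
             (subfield : IsSubfield K (Image K ι)) where
      open OverSubfield K ι
      open IsSubfield subfield

      0F 1F : Fin q
      0F = proj₁ has0
      1F = proj₁ has1

      ι-0F : ι 0F ≈ 0#
      ι-0F = proj₂ has0

      ι-1F : ι 1F ≈ 1#
      ι-1F = proj₂ has1

      _+F_ _*F_ : Fin q → Fin q → Fin q
      a +F b = proj₁ (clos+ (a , refl) (b , refl))
      a *F b = proj₁ (clos* (a , refl) (b , refl))

      -F_ : Fin q → Fin q
      -F a = proj₁ (clos- (a , refl))

      ι-+F : ∀ a b → ι (a +F b) ≈ ι a + ι b
      ι-+F a b = proj₂ (clos+ (a , refl) (b , refl))

      ι-*F : ∀ a b → ι (a *F b) ≈ ι a * ι b
      ι-*F a b = proj₂ (clos* (a , refl) (b , refl))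

      ι--F : ∀ a → ι (-F a) ≈ - ι a
      ι--F a = proj₂ (clos- (a , refl))

      inverseF : ∀ a → ¬ (ι a ≈ 0#) → ∃[ b ] (ι a * ι b ≈ 1#)
      inverseF a ιa≉0 = let (y , ιa*y≈1) = inverse (ι a) ιa≉0
                            (b , ιb≈y)   = closInv (a , refl) ιa*y≈1
                        in b , trans (*-cong refl ιb≈y) ιa*y≈1

      -- 0 ≠ 1 in F, so q ≥ 2
      2≤q : 2 ℕ.≤ q
      2≤q = two-distinct 0F 1F (λ eq → 0≉1 (trans (sym ι-0F) (trans (reflexive (≡.cong ι eq)) ι-1F)))
        where
        two-distinct : ∀ {k} (a b : Fin k) → a ≢ b → 2 ℕ.≤ k
        two-distinct {suc zero}    zero zero a≢b = contradiction ≡.refl a≢b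
        two-distinct {suc (suc k)} a    b    a≢b = s≤s (s≤s z≤n)

      lincomb-sum : ∀ {d} (cf : Fin d → Fin q) (w : Fin d → Carrier) →
                    lincomb cf w ≡ ∑[ i < d ] (ι (cf i) * w i)
      lincomb-sum {d} cf w = Σᶠ≡sum d _

      lincomb-cong : ∀ {d} {cf cf′ : Fin d → Fin q} {w w′ : Fin d → Carrier} →
                     (∀ i → cf i ≡ cf′ i) → (∀ i → w i ≈ w′ i) → lincomb cf w ≈ lincomb cf′ w′
      lincomb-cong {d} {cf} {cf′} {w} {w′} cf≗cf′ w≈w′ = begin
        lincomb cf w                     ≡⟨ lincomb-sum cf w ⟩
        ∑[ i < d ] (ι (cf i) * w i)      ≈⟨ sum-cong-≋ (λ i → *-cong (reflexive (≡.cong ι (cf≗cf′ i))) (w≈w′ i)) ⟩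
        ∑[ i < d ] (ι (cf′ i) * w′ i)    ≡⟨ lincomb-sum cf′ w′ ⟨
        lincomb cf′ w′                   ∎

      lincomb-+ : ∀ {d} (cf cf′ : Fin d → Fin q) (w : Fin d → Carrier) →
                  lincomb (λ i → cf i +F cf′ i) w ≈ lincomb cf w + lincomb cf′ w
      lincomb-+ {d} cf cf′ w = begin
        lincomb (λ i → cf i +F cf′ i) w                     ≡⟨ lincomb-sum _ w ⟩
        ∑[ i < d ] (ι (cf i +F cf′ i) * w i)                ≈⟨ sum-cong-≋ (λ i → trans (*-cong (ι-+F (cf i) (cf′ i)) refl) (distribʳ (w i) (ι (cf i)) (ι (cf′ i)))) ⟩
        ∑[ i < d ] (ι (cf i) * w i + ι (cf′ i) * w i)       ≈⟨ ∑-distrib-+ (λ i → ι (cf i) * w i) (λ i → ι (cf′ i) * w i) ⟩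
        ∑[ i < d ] (ι (cf i) * w i) + ∑[ i < d ] (ι (cf′ i) * w i) ≡⟨ ≡.cong₂ _+_ (lincomb-sum cf w) (lincomb-sum cf′ w) ⟨
        lincomb cf w + lincomb cf′ w                        ∎

      lincomb-scale : ∀ {d} a (cf : Fin d → Fin q) (w : Fin d → Carrier) →
                      lincomb (λ i → a *F cf i) w ≈ ι a * lincomb cf w
      lincomb-scale {d} a cf w = begin
        lincomb (λ i → a *F cf i) w          ≡⟨ lincomb-sum _ w ⟩
        ∑[ i < d ] (ι (a *F cf i) * w i)     ≈⟨ sum-cong-≋ (λ i → trans (*-cong (ι-*F a (cf i)) refl) (*-assoc (ι a) (ι (cf i)) (w i))) ⟩
        ∑[ i < d ] (ι a * (ι (cf i) * w i))  ≈⟨ *-distribˡ-sum (ι a) (λ i → ι (cf i) * w i) ⟨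
        ι a * ∑[ i < d ] (ι (cf i) * w i)    ≡⟨ ≡.cong (ι a *_) (lincomb-sum cf w) ⟨
        ι a * lincomb cf w                   ∎

      lincomb-neg : ∀ {d} (cf : Fin d → Fin q) (w : Fin d → Carrier) →
                    lincomb (λ i → -F cf i) w ≈ - lincomb cf w
      lincomb-neg {d} cf w = begin
        lincomb (λ i → -F cf i) w            ≡⟨ lincomb-sum _ w ⟩
        ∑[ i < d ] (ι (-F cf i) * w i)       ≈⟨ sum-cong-≋ (λ i → trans (*-cong (ι--F (cf i)) refl) (sym (-‿distribˡ-* (ι (cf i)) (w i)))) ⟩
        ∑[ i < d ] (- (ι (cf i) * w i))      ≈⟨ -‿sum (λ i → ι (cf i) * w i) ⟨
        - ∑[ i < d ] (ι (cf i) * w i)        ≡⟨ ≡.cong -_ (lincomb-sum cf w) ⟨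
        - lincomb cf w                       ∎

      lincomb-zero : ∀ {d} (w : Fin d → Carrier) → lincomb (λ _ → 0F) w ≈ 0#
      lincomb-zero w = trans (reflexive (lincomb-sum (λ _ → 0F) w)) (sum-zero (λ i → trans (*-cong ι-0F refl) (zeroˡ (w i))))

      independent⇒injective : ∀ {d} {w : Fin d → Carrier} → LinIndep w →
        ∀ cf cf′ → lincomb cf w ≈ lincomb cf′ w → ∀ i → cf i ≡ cf′ i
      independent⇒injective {w = w} indep cf cf′ same i =
        ι-injective _ _ (x∙y⁻¹≈ε⇒x≈y _ _ (trans (sym ι-difference) (indep difference difference≈0 i)))
        where
        difference = λ j → cf j +F (-F cf′ j)
        ι-difference : ι (difference i) ≈ ι (cf i) - ι (cf′ i)
        ι-difference = trans (ι-+F _ _) (+-cong refl (ι--F _))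
        difference≈0 : lincomb difference w ≈ 0#
        difference≈0 = begin
          lincomb difference w                        ≈⟨ lincomb-+ cf _ w ⟩
          lincomb cf w + lincomb (λ j → -F cf′ j) w   ≈⟨ +-cong same (lincomb-neg cf′ w) ⟩
          lincomb cf′ w - lincomb cf′ w               ≈⟨ -‿inverseʳ _ ⟩
          0#                                          ∎

      lincomb-*ʳ : ∀ {d} (cf : Fin d → Fin q) (w : Fin d → Carrier) x →
                   lincomb cf w * x ≈ lincomb cf (λ i → w i * x)
      lincomb-*ʳ {d} cf w x = begin
        lincomb cf w * x                        ≡⟨ ≡.cong (_* x) (lincomb-sum cf w) ⟩
        ∑[ i < d ] (ι (cf i) * w i) * x         ≈⟨ *-distribʳ-sum x (λ i → ι (cf i) * w i) ⟩
        ∑[ i < d ] (ι (cf i) * w i * x)         ≈⟨ sum-cong-≋ (λ i → *-assoc (ι (cf i)) (w i) x) ⟩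
        ∑[ i < d ] (ι (cf i) * (w i * x))       ≡⟨ lincomb-sum cf (λ i → w i * x) ⟨
        lincomb cf (λ i → w i * x)              ∎

      independent-resp : ∀ {d} {w w′ : Fin d → Carrier} → (∀ i → w i ≈ w′ i) → LinIndep w → LinIndep w′
      independent-resp w≈w′ indep cf lc≈0 = indep cf (trans (lincomb-cong (λ _ → ≡.refl) w≈w′) lc≈0)

      InSpan : ∀ {d} → (Fin d → Carrier) → Carrier → Set ℓ
      InSpan {d} w y = ∃[ cf ] (lincomb cf w ≈ y)

      module _ {d} {w : Fin d → Carrier} where
        span-resp : ∀ {x y} → x ≈ y → InSpan w x → InSpan w y
        span-resp x≈y (cf , lc≈x) = cf , trans lc≈x x≈y

        span-0 : InSpan w 0#
        span-0 = (λ _ → 0F) , lincomb-zero w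

        span-+ : ∀ {x y} → InSpan w x → InSpan w y → InSpan w (x + y)
        span-+ (cf , lc≈x) (cf′ , lc≈y) = (λ i → cf i +F cf′ i) , trans (lincomb-+ cf cf′ w) (+-cong lc≈x lc≈y)

        span-neg : ∀ {x} → InSpan w x → InSpan w (- x)
        span-neg (cf , lc≈x) = (λ i → -F cf i) , trans (lincomb-neg cf w) (-‿cong lc≈x)

        span-scale : ∀ a {x} → InSpan w x → InSpan w (ι a * x)
        span-scale a (cf , lc≈x) = (λ i → a *F cf i) , trans (lincomb-scale a cf w) (*-cong refl lc≈x)

        span-lincomb : ∀ {e} (cf : Fin e → Fin q) {u : Fin e → Carrier} →
                       (∀ i → InSpan w (u i)) → InSpan w (lincomb cf u)
        span-lincomb {zero}  cf u∈ = span-0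
        span-lincomb {suc e} cf u∈ = span-+ (span-scale (cf zero) (u∈ zero)) (span-lincomb (cf ∘ suc) (u∈ ∘ suc))

      module _ {Q : ℕ} (size : HasSize K Q) where
        open Finite size
        open Counting using (count; count-all; count≤; count-mono; count-complement; count-¬-≤; ≤-count-¬; count-≤-∸; count-injection; count-pairs; double-counting)

        lincomb-code : ∀ {d} (cf : Fin d → Fin q) (w : Fin d → Carrier) →
                       lincomb (finToFun {q} {d} (funToFin cf)) w ≈ lincomb cf w
        lincomb-code cf w = lincomb-cong (finToFun-funToFin cf) (λ _ → refl)

        independent? : ∀ {d} (w : Fin d → Carrier) → Dec (LinIndep w)
        independent? {d} w = map′ (λ indep cf lc≈0 i → trans (reflexive (≡.cong ι (≡.sym (finToFun-funToFin cf i))))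
                                                           (indep (funToFin cf) (trans (lincomb-code cf w) lc≈0) i))
                                  (λ indep t → indep (finToFun t))
          (all? (λ t → (lincomb (finToFun {q} {d} t) w ≈? 0#) →-dec all? (λ i → ι (finToFun {q} {d} t i) ≈? 0#)))

        span? : ∀ {d} (w : Fin d → Carrier) y → Dec (InSpan w y)
        span? {d} w y = map′ (λ (t , lc≈y) → finToFun t , lc≈y) (λ (cf , lc≈y) → funToFin cf , trans (lincomb-code cf w) lc≈y)
                             (any? (λ t → lincomb (finToFun {q} {d} t) w ≈? y))

        span-size : ∀ {d} {w : Fin d → Carrier} → LinIndep w → q ℕ.^ d ℕ.≤ count Q (λ x → span? w (element x))
        span-size {d} {w} indep = ℕₚ.≤-trans (ℕₚ.≤-reflexive (≡.sym (count-all (q ℕ.^ d))))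
          (count-injection (q ℕ.^ d) Q (λ _ → yes tt) (λ x → span? w (element x))
            (λ t _ → index (lincomb (finToFun t) w))
            (λ t _ → finToFun t , sym (element-index _))
            (λ t t′ _ _ same → finToFun-injective t t′
               (independent⇒injective indep _ _ (index-injective same))))

        -- K is spanned by d vectors only if |K| ≤ q^d: coordinates determine elements
        spanning⇒size : ∀ {d} {w : Fin d → Carrier} → Spans w → Q ℕ.≤ q ℕ.^ d
        spanning⇒size {d} {w} spans = injective⇒≤ {f = code} code-injective
          where
          coords : Fin Q → Fin d → Fin q
          coords x = proj₁ (spans (element x))
          code : Fin Q → Fin (q ℕ.^ d)
          code x = funToFin (coords x)
          code-injective : ∀ {x y} → code x ≡ code y → x ≡ y
          code-injective {x} {y} same = element-injective x y (begin
            element x                ≈⟨ proj₂ (spans (element x)) ⟨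
            lincomb (coords x) w     ≈⟨ lincomb-cong coords≡ (λ _ → refl) ⟩
            lincomb (coords y) w     ≈⟨ proj₂ (spans (element y)) ⟩
            element y                ∎)
            where
            coords≡ : ∀ i → coords x i ≡ coords y i
            coords≡ i = ≡.trans (≡.sym (finToFun-funToFin (coords x) i))
                          (≡.trans (≡.cong (λ t → finToFun t i) same) (finToFun-funToFin (coords y) i))

        -- d independent vectors with |K| ≤ q^d span K: otherwise the span
        -- (of size q^d) would miss some element of K.
        independent⇒spanning : ∀ {d} {w : Fin d → Carrier} → LinIndep w → Q ℕ.≤ q ℕ.^ d → Spans w
        independent⇒spanning {d} {w} indep Q≤ y with span? w y
        ... | yes y∈ = y∈
        ... | no  y∉ = contradiction (ℕₚ.≤-trans missed (count-¬-≤ Q (λ x → span? w (element x)) (span-size indep)))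
                                     (λ 1≤Q∸qᵈ → ℕₚ.<⇒≱ 1≤Q∸qᵈ (ℕₚ.≤-reflexive (ℕₚ.m≤n⇒m∸n≡0 Q≤)))
          where
          missed : 1 ℕ.≤ count Q (λ x → ¬? (span? w (element x)))
          missed = count-injection 1 Q (λ _ → yes tt) (λ x → ¬? (span? w (element x))) (λ _ _ → index y)
                     (λ _ _ → y∉ ∘ span-resp (element-index y)) (λ { zero zero _ _ _ → ≡.refl })

        ∷-independent : ∀ {k} x (w : Fin k → Carrier) → LinIndep (x ∷ w) → LinIndep w × ¬ InSpan w x
        ∷-independent x w indep = tail-independent , head-outside
          where
          tail-independent : LinIndep w
          tail-independent cf lc≈0 i =
            indep (0F ∷ cf) (trans (+-cong (trans (*-cong ι-0F refl) (zeroˡ x)) lc≈0) (+-identityˡ 0#)) (suc i)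
          -1≉0 : ¬ (- 1# ≈ 0#)
          -1≉0 -1≈0 = 0≉1 (sym (begin
            1#          ≈⟨ +-identityʳ 1# ⟨
            1# + 0#     ≈⟨ +-cong refl -1≈0 ⟨
            1# - 1#     ≈⟨ -‿inverseʳ 1# ⟩
            0#          ∎))
          head-outside : ¬ InSpan w x
          head-outside (cf , lc≈x) = -1≉0 (trans (sym (trans (ι--F 1F) (-‿cong ι-1F)))
            (indep ((-F 1F) ∷ cf) (begin
              ι (-F 1F) * x + lincomb cf w   ≈⟨ +-cong (*-cong (trans (ι--F 1F) (-‿cong ι-1F)) refl) lc≈x ⟩
              - 1# * x + x                   ≈⟨ +-cong (-1*x≈-x x) refl ⟩
              - x + x                        ≈⟨ -‿inverseˡ x ⟩
              0#                             ∎) zero))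

        #independent : ℕ → ℕ
        #independent k = count (Q ℕ.^ k) (λ a → independent? (tuple {k} a))

        -- Choosing an independent (k+1)-tuple: an independent k-tuple, then a
        -- head outside its span, which has Q - q^k choices.
        #independent-suc : ∀ k → #independent (suc k) ℕ.≤ #independent k ℕ.* (Q ∸ q ℕ.^ k)
        #independent-suc k = count-pairs Q (Q ℕ.^ k) (λ a → independent? (tuple {suc k} a))
          (λ t → independent? (tuple {k} t)) (Q ∸ q ℕ.^ k)
          (λ x t indep → proj₁ (∷-independent _ _ (independent-resp (tuple-combine x t) indep)))
          (λ t indep → ℕₚ.≤-trans
             (count-mono Q (λ x → independent? (tuple {suc k} (combine x t))) (λ x → ¬? (span? (tuple {k} t) (element x)))
               (λ x indep′ → proj₂ (∷-independent _ _ (independent-resp (tuple-combine x t) indep′))))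
             (count-¬-≤ Q (λ x → span? (tuple {k} t) (element x)) (span-size indep)))

        #independent≤∏ : ∀ k → #independent k ℕ.≤ ∏ℕ k (λ i → Q ∸ q ℕ.^ i)
        #independent≤∏ zero    = count≤ 1 (λ a → independent? (tuple {0} a))
        #independent≤∏ (suc k) = ℕₚ.≤-trans (#independent-suc k) (ℕₚ.*-monoˡ-≤ (Q ∸ q ℕ.^ k) (#independent≤∏ k))

        module _ (α : Carrier) (generates : Generates α) where

          powers : (d : ℕ) → Fin d → Carrier
          powers d i = pow K α (toℕ i)

          lincomb-powers-last : ∀ d (cf : Fin (suc d) → Fin q) →
            lincomb cf (powers (suc d)) ≈ lincomb (cf ∘ inject₁) (powers d) + ι (cf (fromℕ d)) * pow K α d
          lincomb-powers-last d cf = begin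
            lincomb cf (powers (suc d))                                     ≡⟨ lincomb-sum cf (powers (suc d)) ⟩
            ∑[ i < suc d ] (ι (cf i) * powers (suc d) i)                    ≈⟨ sum-init-last (λ i → ι (cf i) * powers (suc d) i) ⟩
            ∑[ i < d ] (ι (cf (inject₁ i)) * pow K α (toℕ (inject₁ i)))
              + ι (cf (fromℕ d)) * pow K α (toℕ (fromℕ d))                  ≈⟨ +-cong (sum-cong-≋ {d} (λ i → *-cong refl (reflexive (≡.cong (pow K α) (toℕ-inject₁ i)))))
                                                                                       (*-cong refl (reflexive (≡.cong (pow K α) (toℕ-fromℕ d)))) ⟩
            ∑[ i < d ] (ι (cf (inject₁ i)) * powers d i) + ι (cf (fromℕ d)) * pow K α d
                                                                            ≡⟨ ≡.cong (_+ ι (cf (fromℕ d)) * pow K α d) (lincomb-sum (cf ∘ inject₁) (powers d)) ⟨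
            lincomb (cf ∘ inject₁) (powers d) + ι (cf (fromℕ d)) * pow K α d ∎

          α*lincomb-powers : ∀ d (cf : Fin d → Fin q) →
                             α * lincomb cf (powers d) ≈ lincomb (0F ∷ cf) (powers (suc d))
          α*lincomb-powers d cf = begin
            α * lincomb cf (powers d)                          ≈⟨ *-comm α _ ⟩
            lincomb cf (powers d) * α                          ≈⟨ lincomb-*ʳ cf (powers d) α ⟩
            lincomb cf (λ i → powers d i * α)                  ≈⟨ +-identityˡ _ ⟨
            0# + lincomb cf (λ i → powers d i * α)             ≈⟨ +-cong (trans (*-cong ι-0F refl) (zeroˡ 1#)) refl ⟨
            ι 0F * 1# + lincomb cf (λ i → powers d i * α)      ∎

          -- 1 = α⁰ is among the powers unless d = 0, when it is α^d itself
          1∈powers : ∀ d → InSpan (powers d) (pow K α d) → InSpan (powers d) 1#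
          1∈powers zero    top∈ = top∈
          1∈powers (suc d) _    = (1F ∷ λ _ → 0F) ,
            trans (+-cong (trans (*-cong ι-1F refl) (*-identityˡ 1#)) (lincomb-zero (λ i → powers (suc d) (suc i)))) (+-identityʳ 1#)

          -- If α^d lies in the span V of 1, α, …, α^(d-1), then V is a
          -- subfield containing F and α, hence all of K, so |K| ≤ q^d.
          module _ {d : ℕ} (top∈ : InSpan (powers d) (pow K α d)) where
            private
              V : Carrier → Set ℓ
              V = InSpan (powers d)

            V-α : ∀ {x} → V x → V (α * x)
            V-α {x} (cf , lc≈x) = span-resp α*x≈ (span-+ (cf′ ∘ inject₁ , refl) (span-scale (cf′ (fromℕ d)) top∈))
              where
              cf′ = 0F ∷ cf
              α*x≈ : lincomb (cf′ ∘ inject₁) (powers d) + ι (cf′ (fromℕ d)) * pow K α d ≈ α * x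
              α*x≈ = trans (sym (lincomb-powers-last d cf′)) (trans (sym (α*lincomb-powers d cf)) (*-cong refl lc≈x))

            -- V is closed under multiplication by powers of α, hence by V
            V-powα : ∀ k {y} → V y → V (pow K α k * y)
            V-powα zero    {y} y∈ = span-resp (sym (*-identityˡ y)) y∈
            V-powα (suc k) {y} y∈ = span-resp (sym (*-assoc _ _ _)) (V-powα k (V-α y∈))

            V-* : ∀ {x y} → V x → V y → V (x * y)
            V-* {x} {y} (cf , lc≈x) y∈ =
              span-resp (trans (sym (lincomb-*ʳ cf (powers d) y)) (*-cong lc≈x refl))
                        (span-lincomb cf (λ i → V-powα (toℕ i) y∈))

            V-1 : V 1#
            V-1 = 1∈powers d top∈

            -- V contains 1 and the powers of its elements, so also inverses
            V-pow : ∀ {x} → V x → ∀ k → V (pow K x k)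
            V-pow x∈ zero    = V-1
            V-pow x∈ (suc k) = V-* (V-pow x∈ k) x∈

            V-subfield : IsSubfield K V
            V-subfield = record
              { resp    = span-resp
              ; has0    = span-0
              ; has1    = V-1
              ; clos+   = span-+
              ; clos-   = span-neg
              ; clos*   = V-*
              ; closInv = λ x∈ xy≈1 → let (s , xˢ≈y) = inverse-is-power xy≈1 in span-resp xˢ≈y (V-pow x∈ s)
              }

            top∈⇒size : Q ℕ.≤ q ℕ.^ d
            top∈⇒size = spanning⇒size (generates V V-subfield
              (λ a → span-resp (*-identityʳ (ι a)) (span-scale a V-1))
              (span-resp (*-identityʳ α) (V-α V-1)))

          -- As long as q^d ≤ |K|, the powers 1, α, …, α^(d-1) are independent:
          -- a relation with nonzero top coefficient would put α^(d-1) in the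
          -- span of the lower powers, forcing |K| ≤ q^(d-1).
          powers-independent : ∀ d → q ℕ.^ d ℕ.≤ Q → LinIndep (powers d)
          powers-independent zero    _        cf lc≈0 ()
          powers-independent (suc d) qᵈ⁺¹≤Q cf lc≈0 with ι (cf (fromℕ d)) ≈? 0#
          ... | yes top≈0 = every-coefficient
            where
            lower≈0 : lincomb (cf ∘ inject₁) (powers d) ≈ 0#
            lower≈0 = begin
              lincomb (cf ∘ inject₁) (powers d)                                  ≈⟨ +-identityʳ _ ⟨
              lincomb (cf ∘ inject₁) (powers d) + 0#                             ≈⟨ +-cong refl (trans (*-cong top≈0 refl) (zeroˡ _)) ⟨
              lincomb (cf ∘ inject₁) (powers d) + ι (cf (fromℕ d)) * pow K α d   ≈⟨ lincomb-powers-last d cf ⟨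
              lincomb cf (powers (suc d))                                        ≈⟨ lc≈0 ⟩
              0#                                                                 ∎
            every-coefficient : ∀ i → ι (cf i) ≈ 0#
            every-coefficient i with view i
            ... | ‵fromℕ     = top≈0
            ... | ‵inject₁ j = powers-independent d (ℕₚ.≤-trans (ℕₚ.<⇒≤ qᵈ<qᵈ⁺¹) qᵈ⁺¹≤Q) (cf ∘ inject₁) lower≈0 j
              where qᵈ<qᵈ⁺¹ = ℕₚ.^-monoʳ-< q 2≤q (ℕₚ.n<1+n d)
          ... | no top≉0 = contradiction (top∈⇒size top∈) (ℕₚ.<⇒≱ (ℕₚ.<-≤-trans (ℕₚ.^-monoʳ-< q 2≤q (ℕₚ.n<1+n d)) qᵈ⁺¹≤Q))
            where
            t = cf (fromℕ d)
            lower = lincomb (cf ∘ inject₁) (powers d)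
            t⁻¹ = proj₁ (inverseF t top≉0)
            top∈ : InSpan (powers d) (pow K α d)
            top∈ = span-resp αᵈ≈ (span-scale t⁻¹ (span-neg (cf ∘ inject₁ , refl)))
              where
              tαᵈ≈-lower : ι t * pow K α d ≈ - lower
              tαᵈ≈-lower = +-inverseʳ-unique lower _ (trans (sym (lincomb-powers-last d cf)) lc≈0)
              αᵈ≈ : ι t⁻¹ * - lower ≈ pow K α d
              αᵈ≈ = begin
                ι t⁻¹ * - lower                ≈⟨ *-cong refl tαᵈ≈-lower ⟨
                ι t⁻¹ * (ι t * pow K α d)      ≈⟨ *-assoc _ _ _ ⟨
                (ι t⁻¹ * ι t) * pow K α d      ≈⟨ *-cong (trans (*-comm _ _) (proj₂ (inverseF t top≉0))) refl ⟩
                1# * pow K α d                 ≈⟨ *-identityˡ _ ⟩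
                pow K α d                      ∎

          module _ (m′ n′ : ℕ) (Q≡ : Q ≡ q ℕ.^ (suc m′ ℕ.* suc n′)) where

            m n : ℕ
            m = suc m′
            n = suc n′

            pair : Fin n → Fin m → Fin (n ℕ.* m)
            pair = combine

            -- A coefficient matrix P (entries in F) acts on v ∈ K^m through the
            -- linear form v ↦ Σ_j c_j v_j, where c_j = Σ_i P_ij α^i is column j
            -- read as an element of K.
            Matrix : Set
            Matrix = Fin n → Fin m → Fin q

            column : Matrix → Fin m → Carrier
            column P j = lincomb (λ i → P i j) (powers n)

            form : Matrix → (Fin m → Carrier) → Carrier
            form P v = ∑[ j < m ] (column P j * v j)

            form-cong : ∀ {P P′ : Matrix} → (∀ i j → P i j ≡ P′ i j) → ∀ v → form P v ≈ form P′ v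
            form-cong {P} {P′} P≡P′ v = sum-cong-≋ {m} {λ j → column P j * v j} {λ j → column P′ j * v j}
              (λ j → *-cong (lincomb-cong {w = powers n} (λ i → P≡P′ i j) (λ _ → refl)) refl)

            family-at : ∀ v i j → family m n α v (pair i j) ≈ powers n i * v j
            family-at v i j = reflexive (≡.cong (λ qr → pow K α (toℕ (proj₁ qr)) * v (proj₂ qr))
                                                (remQuot-combine {n} {m} i j))

            family-lincomb : ∀ (cf : Fin (n ℕ.* m) → Fin q) v →
                             lincomb cf (family m n α v) ≈ form (λ i j → cf (pair i j)) v
            family-lincomb cf v = begin
              lincomb cf (family m n α v)                                                  ≡⟨ lincomb-sum cf (family m n α v) ⟩
              ∑[ x < n ℕ.* m ] (ι (cf x) * family m n α v x)                                ≈⟨ sum-combine n m (λ x → ι (cf x) * family m n α v x) ⟩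
              ∑[ i < n ] ∑[ j < m ] (ι (cf (pair i j)) * family m n α v (pair i j))   ≈⟨ sum-cong-≋ {n} (λ i → sum-cong-≋ {m} {λ j → ι (cf (pair i j)) * family m n α v (pair i j)} {λ j → ι (cf (pair i j)) * (powers n i * v j)} (λ j → *-cong refl (family-at v i j))) ⟩
              ∑[ i < n ] ∑[ j < m ] (ι (cf (pair i j)) * (powers n i * v j))             ≈⟨ ∑-comm {n} {m} (λ i j → ι (cf (pair i j)) * (powers n i * v j)) ⟩
              ∑[ j < m ] ∑[ i < n ] (ι (cf (pair i j)) * (powers n i * v j))             ≈⟨ sum-cong-≋ {m} (λ j → trans
                                                                                                  (reflexive (≡.sym (lincomb-sum (λ i → cf (pair i j)) (λ i → powers n i * v j))))
                                                                                                  (sym (lincomb-*ʳ (λ i → cf (pair i j)) (powers n) (v j)))) ⟩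
              form (λ i j → cf (pair i j)) v                                            ∎

            -- a matrix with a nonzero entry in column j₀ has c_{j₀} ≉ 0, because
            -- 1, α, …, α^(n-1) are independent (q^n ≤ q^(mn))
            column-nonzero : ∀ P i₀ j₀ → ¬ (ι (P i₀ j₀) ≈ 0#) → ¬ (column P j₀ ≈ 0#)
            column-nonzero P i₀ j₀ Pᵢⱼ≉0 cⱼ≈0 = Pᵢⱼ≉0 (powers-independent n qⁿ≤Q (λ i → P i j₀) cⱼ≈0 i₀)
              where
              instance _ = ℕ.>-nonZero (ℕₚ.<-≤-trans (s≤s z≤n) 2≤q)
              qⁿ≤Q : q ℕ.^ n ℕ.≤ Q
              qⁿ≤Q = ℕₚ.≤-trans (ℕₚ.^-monoʳ-≤ q (ℕₚ.m≤m+n n (m′ ℕ.* n))) (ℕₚ.≤-reflexive (≡.sym Q≡))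

            -- A good tuple v is itself independent: a relation Σ c_j v_j ≈ 0
            -- is the combination of the family with coefficients c_j at α⁰ v_j.
            good⇒independent : ∀ v → GoodTuple m n α v → LinIndep v
            good⇒independent v (family-independent , _) cf lc≈0 j =
              trans (reflexive (≡.cong ι (≡.sym (flat-combine zero j))))
                    (family-independent flat (trans (family-lincomb flat v) (trans (form-cong flat-combine v) form≈0)) (pair zero j))
              where
              P : Matrix
              P zero    j = cf j
              P (suc _) j = 0F
              flat : Fin (n ℕ.* m) → Fin q
              flat x = P (proj₁ (remQuot {n} m x)) (proj₂ (remQuot {n} m x))
              flat-combine : ∀ i j → flat (pair i j) ≡ P i j
              flat-combine i j = ≡.cong (λ qr → P (proj₁ qr) (proj₂ qr)) (remQuot-combine {n} {m} i j)
              column-P : ∀ j → column P j ≈ ι (cf j)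
              column-P j = trans (+-cong (*-identityʳ _) (lincomb-zero (λ i → powers n (suc i)))) (+-identityʳ _)
              form≈0 : form P v ≈ 0#
              form≈0 = trans (sum-cong-≋ {m} {λ j → column P j * v j} {λ j → ι (cf j) * v j} (λ j → *-cong (column-P j) refl)) (trans (reflexive (≡.sym (lincomb-sum cf v))) lc≈0)

            upper-bound : ∀ N → IsCountOfBases m n α N → N ℕ.≤ ∏ℕ m (λ i → Q ∸ q ℕ.^ i)
            upper-bound N (f , f-good , f-injective , _) = ℕₚ.≤-trans N≤#independent (#independent≤∏ m)
              where
              N≤#independent : N ℕ.≤ #independent m
              N≤#independent = ℕₚ.≤-trans (ℕₚ.≤-reflexive (≡.sym (count-all N)))
                (count-injection N (Q ℕ.^ m) (λ _ → yes tt) (λ a → independent? (tuple {m} a))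
                  (λ k _ → tupleIndex (f k))
                  (λ k _ → independent-resp (λ j → sym (tuple-tupleIndex (f k) j)) (good⇒independent (f k) (f-good k)))
                  (λ k k′ _ _ same → f-injective k k′ (λ j →
                     trans (sym (tuple-tupleIndex (f k) j))
                           (trans (reflexive (≡.cong (λ a → tuple {m} a j) same)) (tuple-tupleIndex (f k′) j)))))

            B : ℕ
            B = (q ℕ.^ m) ℕ.^ n

            B≡Q : B ≡ Q
            B≡Q = ≡.trans (ℕₚ.^-*-assoc q m n) (≡.sym Q≡)

            matrix : Fin B → Matrix
            matrix b i j = finToFun {q} {m} (finToFun {q ℕ.^ m} {n} b i) j

            matrixIndex : Matrix → Fin B
            matrixIndex P = funToFin (λ i → funToFin (P i))

            matrix-matrixIndex : ∀ P i j → matrix (matrixIndex P) i j ≡ P i j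
            matrix-matrixIndex P i j =
              ≡.trans (≡.cong (λ t → finToFun t j) (finToFun-funToFin (λ i → funToFin (P i)) i)) (finToFun-funToFin (P i) j)

            NonZero : Matrix → Set ℓ
            NonZero P = ∃[ i ] ∃[ j ] ¬ (ι (P i j) ≈ 0#)

            nonzero? : ∀ P → Dec (NonZero P)
            nonzero? P = any? (λ i → any? (λ j → ¬? (ι (P i j) ≈? 0#)))

            -- P kills v: P is a nontrivial F-relation among the family of v
            Kills : Matrix → (Fin m → Carrier) → Set ℓ
            Kills P v = NonZero P × form P v ≈ 0#

            kills? : ∀ P v → Dec (Kills P v)
            kills? P v = nonzero? P ×-dec (form P v ≈? 0#)

            Bad : Fin (Q ℕ.^ m) → Set ℓ
            Bad a = ∃[ b ] Kills (matrix b) (tuple {m} a)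

            bad? : ∀ a → Dec (Bad a)
            bad? a = any? (λ b → kills? (matrix b) (tuple {m} a))

            -- A tuple killed by no matrix is good: its family is independent, and
            -- nm independent vectors span K since |K| = q^(nm).
            ¬bad⇒good : ∀ a → ¬ Bad a → GoodTuple m n α (tuple {m} a)
            ¬bad⇒good a ¬bad = independent , independent⇒spanning {w = family m n α (tuple {m} a)} independent Q≤qⁿᵐ
              where
              v = tuple {m} a
              Q≤qⁿᵐ : Q ℕ.≤ q ℕ.^ (n ℕ.* m)
              Q≤qⁿᵐ = ℕₚ.≤-reflexive (≡.trans Q≡ (≡.cong (q ℕ.^_) (ℕₚ.*-comm m n)))
              independent : LinIndep (family m n α v)
              independent cf lc≈0 x with ι (cf x) ≈? 0#
              ... | yes cₓ≈0 = cₓ≈0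
              ... | no  cₓ≉0 = contradiction (matrixIndex P , (i , j , Pᵢⱼ≉0) , P-kills) ¬bad
                where
                P : Matrix
                P i j = cf (pair i j)
                i = proj₁ (remQuot {n} m x)
                j = proj₂ (remQuot {n} m x)
                Pᵢⱼ≉0 : ¬ (ι (matrix (matrixIndex P) i j) ≈ 0#)
                Pᵢⱼ≉0 = cₓ≉0 ∘ trans (reflexive (≡.cong ι (≡.sym
                          (≡.trans (matrix-matrixIndex P i j) (≡.cong cf (combine-remQuot {n} m x))))))
                P-kills : form (matrix (matrixIndex P)) v ≈ 0#
                P-kills = trans (form-cong (matrix-matrixIndex P) v) (trans (sym (family-lincomb cf v)) lc≈0)

            #good≤N : ∀ N → IsCountOfBases m n α N → count (Q ℕ.^ m) (λ a → ¬? (bad? a)) ℕ.≤ N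
            #good≤N N (f , _ , _ , f-onto) = ℕₚ.≤-trans
              (count-injection (Q ℕ.^ m) N (λ a → ¬? (bad? a)) (λ _ → yes tt) position (λ _ _ → tt) position-injective)
              (ℕₚ.≤-reflexive (count-all N))
              where
              position : ∀ a → ¬ Bad a → Fin N
              position a ¬bad = proj₁ (f-onto (tuple a) (¬bad⇒good a ¬bad))
              position-injective : ∀ a a′ ¬bad ¬bad′ → position a ¬bad ≡ position a′ ¬bad′ → a ≡ a′
              position-injective a a′ ¬bad ¬bad′ same = tuple-injective a a′ (λ j → begin
                tuple a j               ≈⟨ proj₂ (f-onto (tuple a) (¬bad⇒good a ¬bad)) j ⟨
                f (position a ¬bad) j   ≡⟨ ≡.cong (λ k → f k j) same ⟩
                f (position a′ ¬bad′) j ≈⟨ proj₂ (f-onto (tuple a′) (¬bad⇒good a′ ¬bad′)) j ⟩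
                tuple a′ j              ∎)

            -- The kernel of the form of a nonzero matrix has at most Q^(m-1)
            -- elements: the coordinates other than j₀ determine the j₀-th one.
            kernel-size : ∀ P → NonZero P → count (Q ℕ.^ m) (λ a → form P (tuple a) ≈? 0#) ℕ.≤ Q ℕ.^ m′
            kernel-size P (i₀ , j₀ , Pᵢⱼ≉0) = ℕₚ.≤-trans
              (count-injection (Q ℕ.^ m) (Q ℕ.^ m′) (λ a → form P (tuple a) ≈? 0#) (λ _ → yes tt)
                 (λ a _ → others a) (λ _ _ → tt) others-injective)
              (ℕₚ.≤-reflexive (count-all (Q ℕ.^ m′)))
              where
              others : Fin (Q ℕ.^ m) → Fin (Q ℕ.^ m′)
              others a = funToFin (λ j → finToFun {Q} {m} a (punchIn j₀ j))
              others-injective : ∀ a a′ → form P (tuple a) ≈ 0# → form P (tuple a′) ≈ 0# → others a ≡ others a′ → a ≡ a′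
              others-injective a a′ a∈ a′∈ same = finToFun-injective {m} {Q} a a′ agree
                where
                off : ∀ j → finToFun {Q} {m} a (punchIn j₀ j) ≡ finToFun {Q} {m} a′ (punchIn j₀ j)
                off j = ≡.trans (≡.sym (finToFun-funToFin (λ j → finToFun {Q} {m} a (punchIn j₀ j)) j))
                          (≡.trans (≡.cong (λ t → finToFun t j) same) (finToFun-funToFin (λ j → finToFun {Q} {m} a′ (punchIn j₀ j)) j))
                at : tuple a j₀ ≈ tuple a′ j₀
                at = coordinate-determined (column P) (tuple a) (tuple a′) j₀ (column-nonzero P i₀ j₀ Pᵢⱼ≉0)
                       a∈ a′∈ (λ j → reflexive (≡.cong element (off j)))
                agree : ∀ j → finToFun {Q} {m} a j ≡ finToFun {Q} {m} a′ j
                agree j with j₀ ≟F j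
                ... | yes ≡.refl = element-injective _ _ at
                ... | no  j₀≢j   = ≡.trans (≡.cong (finToFun a) (≡.sym (punchIn-punchOut j₀≢j)))
                                     (≡.trans (off (punchOut j₀≢j)) (≡.cong (finToFun a′) (punchIn-punchOut j₀≢j)))

            -- The q-1 nonzero multiples of a matrix killing v are distinct matrices killing v.
            killers≥ : ∀ P v → Kills P v → q ∸ 1 ℕ.≤ count B (λ b → kills? (matrix b) v)
            killers≥ P v ((i₀ , j₀ , Pᵢⱼ≉0) , form≈0) = ℕₚ.≤-trans #nonzero-scalars
              (count-injection q B (λ s → ¬? (ι s ≈? 0#)) (λ b → kills? (matrix b) v)
                 (λ s _ → matrixIndex (s • P)) multiple-kills multiple-injective)
              where
              _•_ : Fin q → Matrix → Matrix
              (s • P) i j = s *F P i j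
              #nonzero-scalars : q ∸ 1 ℕ.≤ count q (λ s → ¬? (ι s ≈? 0#))
              #nonzero-scalars = ≤-count-¬ q (λ s → ι s ≈? 0#)
                (count-injection q 1 (λ s → ι s ≈? 0#) (λ _ → yes tt) (λ _ _ → zero) (λ _ _ → tt)
                   (λ s s′ s≈0 s′≈0 _ → ι-injective s s′ (trans s≈0 (sym s′≈0))))
              multiple-entry : ∀ s i j → ι (matrix (matrixIndex (s • P)) i j) ≈ ι s * ι (P i j)
              multiple-entry s i j = trans (reflexive (≡.cong ι (matrix-matrixIndex (s • P) i j))) (ι-*F s (P i j))
              multiple-form : ∀ s → form (matrix (matrixIndex (s • P))) v ≈ ι s * form P v
              multiple-form s = begin
                form (matrix (matrixIndex (s • P))) v     ≈⟨ form-cong (matrix-matrixIndex (s • P)) v ⟩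
                ∑[ j < m ] (column (s • P) j * v j)       ≈⟨ sum-cong-≋ {m} {λ j → column (s • P) j * v j} {λ j → ι s * (column P j * v j)}
                                                               (λ j → trans (*-cong (lincomb-scale s (λ i → P i j) (powers n)) refl) (*-assoc _ _ _)) ⟩
                ∑[ j < m ] (ι s * (column P j * v j))     ≈⟨ *-distribˡ-sum (ι s) (λ j → column P j * v j) ⟨
                ι s * form P v                            ∎
              multiple-kills : ∀ s → ¬ (ι s ≈ 0#) → Kills (matrix (matrixIndex (s • P))) v
              multiple-kills s s≉0 = (i₀ , j₀ , *-nonzero s≉0 Pᵢⱼ≉0 ∘ trans (sym (multiple-entry s i₀ j₀))) ,
                                     trans (multiple-form s) (trans (*-cong refl form≈0) (zeroʳ _))
              multiple-injective : ∀ s s′ _ _ → matrixIndex (s • P) ≡ matrixIndex (s′ • P) → s ≡ s′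
              multiple-injective s s′ _ _ same = ι-injective s s′ (*-cancelˡ Pᵢⱼ≉0 (begin
                ι (P i₀ j₀) * ι s                               ≈⟨ *-comm _ _ ⟩
                ι s * ι (P i₀ j₀)                               ≈⟨ multiple-entry s i₀ j₀ ⟨
                ι (matrix (matrixIndex (s • P)) i₀ j₀)          ≡⟨ ≡.cong (λ b → ι (matrix b i₀ j₀)) same ⟩
                ι (matrix (matrixIndex (s′ • P)) i₀ j₀)         ≈⟨ multiple-entry s′ i₀ j₀ ⟩
                ι s′ * ι (P i₀ j₀)                              ≈⟨ *-comm _ _ ⟩
                ι (P i₀ j₀) * ι s′                              ∎))

            #nonzero≤ : count B (λ b → nonzero? (matrix b)) ℕ.≤ B ∸ 1
            #nonzero≤ = count-≤-∸ B (λ b → nonzero? (matrix b))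
              (count-injection 1 B (λ _ → yes tt) (λ b → ¬? (nonzero? (matrix b))) (λ _ _ → matrixIndex zeroMatrix)
                 (λ _ _ (i , j , entry≉0) → entry≉0 (trans (reflexive (≡.cong ι (matrix-matrixIndex zeroMatrix i j))) ι-0F))
                 (λ { zero zero _ _ _ → ≡.refl }))
              where
              zeroMatrix : Matrix
              zeroMatrix _ _ = 0F

            -- Double counting the pairs (v , P) with P killing v: each bad v
            -- has ≥ q-1 killers, each nonzero P kills ≤ Q^(m-1) tuples.
            #bad-bound : count (Q ℕ.^ m) bad? ℕ.* (q ∸ 1) ℕ.≤ (Q ∸ 1) ℕ.* Q ℕ.^ m′
            #bad-bound = ℕₚ.≤-trans
              (double-counting (Q ℕ.^ m) B (λ a b → kills? (matrix b) (tuple a)) bad? (λ b → nonzero? (matrix b))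
                 (q ∸ 1) (Q ℕ.^ m′) rows≥ columns≤ (λ _ _ → proj₁))
              (ℕₚ.≤-trans (ℕₚ.*-monoˡ-≤ (Q ℕ.^ m′) #nonzero≤)
                          (ℕₚ.≤-reflexive (≡.cong (λ k → (k ∸ 1) ℕ.* Q ℕ.^ m′) B≡Q)))
              where
              rows≥ : ∀ a → Bad a → q ∸ 1 ℕ.≤ count B (λ b → kills? (matrix b) (tuple a))
              rows≥ a (b , kills) = killers≥ (matrix b) (tuple a) kills
              columns≤ : ∀ b → NonZero (matrix b) → count (Q ℕ.^ m) (λ a → kills? (matrix b) (tuple a)) ℕ.≤ Q ℕ.^ m′
              columns≤ b nonzero = ℕₚ.≤-trans
                (count-mono (Q ℕ.^ m) (λ a → kills? (matrix b) (tuple a)) (λ a → form (matrix b) (tuple a) ≈? 0#) (λ _ → proj₂))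
                (kernel-size (matrix b) nonzero)

            lower-bound : ∀ N → IsCountOfBases m n α N → ((q ∸ 2) ℕ.* Q ℕ.+ 1) ℕ.* Q ℕ.^ m′ ℕ.≤ (q ∸ 1) ℕ.* N
            lower-bound N counts = lower-bound-arithmetic q Q (Q ℕ.^ m′) _ _ N 2≤q 1≤Q
              #bad-bound (count-complement (Q ℕ.^ m) bad?) (#good≤N N counts)
              where
              1≤Q : 1 ℕ.≤ Q
              1≤Q = ℕ.>-nonZero⁻¹ Q {{nonZeroIndex (index 0#)}}

open import Data.Nat using (_+_; _*_; _^_; _≤_)
open import Data.Nat.Primality using (Prime)

-- With
-- m = m′+1, n = n′+1 and Q = q^(mn), both bounds were proved above; only
-- Q^(m-1) = q^(mn(m-1)) remains to be rewritten.
lemma6p1 : ∀ {c ℓ : Level} (q m n : ℕ)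
  → (∃[ p ] ∃[ k ] (Prime p × 1 ≤ k × q ≡ p ^ k))
  → 1 ≤ m → 1 ≤ n
  → (K : CommutativeRing c ℓ) → IsField K
  → HasSize K (q ^ (m * n))
  → (ι : Fin q → CommutativeRing.Carrier K)
  → (∀ a b → CommutativeRing._≈_ K (ι a) (ι b) → a ≡ b)
  → IsSubfield K (Image K ι)
  → (α : CommutativeRing.Carrier K)
  → OverSubfield.Generates K ι α
  → (N : ℕ) → OverSubfield.IsCountOfBases K ι m n α N
  → ((q ∸ 2) * q ^ (m * n) + 1) * q ^ (m * n * (m ∸ 1)) ≤ (q ∸ 1) * N
    × N ≤ ∏ℕ m (λ i → q ^ (m * n) ∸ q ^ i)
lemma6p1 q (suc m′) (suc n′) _ (s≤s z≤n) (s≤s z≤n) K isField size ι ι-injective subfield α generates N counts =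
  ≡.subst (λ X → ((q ∸ 2) * Q + 1) * X ≤ (q ∸ 1) * N) (ℕₚ.^-*-assoc q (suc m′ * suc n′) m′)
          (lower-bound K isField ι ι-injective subfield size α generates m′ n′ ≡.refl N counts) ,
  upper-bound K isField ι ι-injective subfield size α generates m′ n′ ≡.refl N counts
  where
  Q = q ^ (suc m′ * suc n′)
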